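{- Let $0<p<1$. Suppose a binary search tree has right height $d$, and a new element larger than all elements in the tree is inserted as a new rightmost leaf, followed by \textsc{RebalanceZig}. Then afterwards the right height is $d$ with probability $1-p^{d+1}$ and $d+1$ with probability $p^{d+1}$.
   Context: The right height of a binary search tree is the depth of its rightmost node (depth = number of edges to the root). \textsc{RebalanceZig}$(v)$, applied at the newly inserted leaf $v$: while $v$ has a parent and an independent coin flip shows tail (tail has probability $p$, head probability $1-p$), set $v\gets$ parent of $v$; afterwards, if $v$ has a parent, rotate $v$ up (the standard single rotation at the parent of $v$ that moves $v$ one level up). -}

module Defs where

open import Level using (Level)
open import Data.Nat using (ℕ; zero; suc; _<_; _<ᵇ_)
open import Data.Nat.Properties using (_≟_)
open import Data.Bool using (Bool; true; false; if_then_else_)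
open import Data.List using (List; []; _∷_; _++_; map)
open import Data.Product using (_×_; _,_; proj₁; proj₂)
open import Relation.Nullary using (does)
open import Algebra.Bundles using (CommutativeRing)

data Tree : Set where
  leaf : Tree
  node : Tree → ℕ → Tree → Tree

data AllKeys (P : ℕ → Set) : Tree → Set where
  leaf : AllKeys P leaf
  node : ∀ {l x r} → AllKeys P l → P x → AllKeys P r → AllKeys P (node l x r)

data IsBST : Tree → Set where
  leaf : IsBST leaf
  node : ∀ {l x r} → IsBST l → IsBST r →
         AllKeys (_< x) l → AllKeys (x <_) r → IsBST (node l x r)

data NonEmpty : Tree → Set where
  node : ∀ {l x r} → NonEmpty (node l x r)

-- right height: depth (number of edges from the root) of the rightmost node
-- (only meaningful for nonempty trees)
rightHeight : Tree → ℕ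
rightHeight leaf = 0
rightHeight (node l x leaf) = 0
rightHeight (node l x r@(node _ _ _)) = suc (rightHeight r)

data Ctx : Set where
  top : Ctx
  goL : ℕ → Tree → Ctx → Ctx   -- focus is the left child of (node _ x r)
  goR : Tree → ℕ → Ctx → Ctx   -- focus is the right child of (node l x _)

Focus : Set
Focus = Tree × Ctx

plug : Tree → Ctx → Tree
plug t top = t
plug t (goL x r c) = plug (node t x r) c
plug t (goR l x c) = plug (node l x t) c

insertZ : ℕ → Tree → Ctx → Focus
insertZ k leaf c = node leaf k leaf , c
insertZ k (node l x r) c =
  if k <ᵇ x then insertZ k l (goL x r c) else insertZ k r (goR l x c)

insertAt : ℕ → Tree → Focus
insertAt k t = insertZ k t top

-- single rotation at the parent of the focused node, moving it one level up
-- (identity if the focus has no parent, or the focus is empty)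
rotateUp : Focus → Focus
rotateUp (node a y b , goL x r c) = node a y (node b x r) , c
rotateUp (node a y b , goR l x c) = node (node l x a) y b , c
rotateUp f = f

module Prob {c ℓ} (R : CommutativeRing c ℓ) where
  open CommutativeRing R

  Dist : Set → Set c
  Dist A = List (Carrier × A)

  return : ∀ {A} → A → Dist A
  return a = (1# , a) ∷ []

  scale : ∀ {A} → Carrier → Dist A → Dist A
  scale w = map (λ { (v , a) → (w * v , a) })

  _^_ : Carrier → ℕ → Carrier
  x ^ zero = 1#
  x ^ suc n = x * (x ^ n)

  Pr : ∀ {A} → Dist A → (A → Bool) → Carrier
  Pr [] E = 0#
  Pr ((w , a) ∷ d) E = (if E a then w else 0#) + Pr d E

  mapD : ∀ {A B : Set} → (A → B) → Dist A → Dist B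
  mapD f = map (λ { (w , a) → (w , f a) })

  module _ (p : Carrier) where
    -- the walking-up phase of RebalanceZig: while the node has a parent and a
    -- coin flip shows tail (probability p), move to the parent;
    -- head has probability 1 - p
    walkUp : Tree → Ctx → Dist Focus
    walkUp t top = return (t , top)
    walkUp t (goL x r c) =
      scale p (walkUp (node t x r) c) ++ scale (1# - p) (return (t , goL x r c))
    walkUp t (goR l x c) =
      scale p (walkUp (node l x t) c) ++ scale (1# - p) (return (t , goR l x c))

    rebalanceZig : Focus → Dist Tree
    rebalanceZig (t , c) =
      mapD (λ f → plug (proj₁ (rotateUp f)) (proj₂ (rotateUp f))) (walkUp t c)

    insertZig : ℕ → Tree → Dist Tree
    insertZig k t = rebalanceZig (insertAt k t)

    rightHeightIs : ℕ → Tree → Bool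
    rightHeightIs d t = does (rightHeight t ≟ d)

{-# OPTIONS --safe #-}
module Submission where

-- A key above every key of the tree is inserted at the end of the right spine, at depth
-- d + 1.  Walking up from there and rotating at a node on the right spine lowers the
-- right height by exactly one, since the rotated node keeps its right subtree; only a
-- walk that reaches the root, after d + 1 tails, rotates nothing.  Conditioning on the
-- first coin flip gives a recursion in the depth whose solution is
-- (1 - p ^ n, p ^ n) for the heights (d, d + 1) from depth n.

open import Defs
open import Data.Nat as ℕ using (ℕ; suc; _<_)
open import Data.Nat.Properties as ℕₚ using (_≟_; _<?_; suc-injective; <⇒≯; 1+n≢n)
open import Data.Bool using (Bool; true; false; if_then_else_)
open import Data.List using (_∷_; []; _++_)
open import Data.Product using (_×_; _,_; proj₁; proj₂)
open import Function using (_∘_)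
open import Algebra.Bundles using (CommutativeRing)
open import Relation.Binary.PropositionalEquality as ≡ using (_≡_; refl; cong; cong₂; subst)
open import Relation.Nullary.Decidable using (does; dec-true; dec-false)
import Algebra.Properties.Ring as RingProperties
import Algebra.Solver.Ring.NaturalCoefficients.Default as SemiringSolver
import Relation.Binary.Reasoning.Setoid as SetoidReasoning

data RightSpine : Ctx → ℕ → Set where
  top : RightSpine top 0
  goR : ∀ {l x c n} → RightSpine c n → RightSpine (goR l x c) (suc n)

descendRight : Tree → Ctx → Ctx
descendRight leaf c = c
descendRight (node l x r) c = descendRight r (goR l x c)

rotateUpTree : Focus → Tree
rotateUpTree f = plug (proj₁ (rotateUp f)) (proj₂ (rotateUp f))

rightHeight-ignores-left : ∀ l l′ x r → rightHeight (node l x r) ≡ rightHeight (node l′ x r)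
rightHeight-ignores-left l l′ x leaf = refl
rightHeight-ignores-left l l′ x (node _ _ _) = refl

rightHeight-plug : ∀ {t c n} → RightSpine c n → NonEmpty t → rightHeight (plug t c) ≡ rightHeight t ℕ.+ n
rightHeight-plug top node = ≡.sym (ℕₚ.+-identityʳ _)
rightHeight-plug {n = suc n} (goR {n = n} s) node = ≡.trans (rightHeight-plug s node) (≡.sym (ℕₚ.+-suc _ n))

rightHeight-rotateUpTree-goR : ∀ {a y b l x c n} → RightSpine c n →
  suc (rightHeight (rotateUpTree (node a y b , goR l x c))) ≡ rightHeight (plug (node a y b) (goR l x c))
rightHeight-rotateUpTree-goR {a} {y} {b} {l} {x} {c} {n} s = begin
  suc (rightHeight (plug (node (node l x a) y b) c))
    ≡⟨ cong suc (rightHeight-plug s node) ⟩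
  suc (rightHeight (node (node l x a) y b) ℕ.+ n)
    ≡⟨ cong (λ h → suc (h ℕ.+ n)) (rightHeight-ignores-left _ a y b) ⟩
  suc (rightHeight (node a y b) ℕ.+ n)
    ≡⟨ ≡.sym (rightHeight-plug s node) ⟩
  rightHeight (plug (node a y b) (goR l x c))
    ∎
  where open ≡.≡-Reasoning

descendRight-rightSpine : ∀ {c n} t → NonEmpty t → RightSpine c n →
  RightSpine (descendRight t c) (suc (rightHeight t) ℕ.+ n)
descendRight-rightSpine (node l x leaf) node s = goR s
descendRight-rightSpine {n = n} (node l x r@(node _ _ _)) node s =
  subst (RightSpine _) (ℕₚ.+-suc (suc (rightHeight r)) n) (descendRight-rightSpine r node (goR s))

insertZ-above : ∀ {k t} c → AllKeys (_< k) t → insertZ k t c ≡ (node leaf k leaf , descendRight t c)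
insertZ-above c leaf = refl
insertZ-above {k} {node l x r} c (node _ x<k above-r)
  rewrite dec-false (k <? x) (<⇒≯ x<k) = insertZ-above (goR l x c) above-r

module _ {c ℓ} (R : CommutativeRing c ℓ) where
  open CommutativeRing R renaming (refl to ≈-refl)
  open Prob R
  open SetoidReasoning setoid
  open RingProperties ring using (x[y-z]≈xy-xz)
  open SemiringSolver commutativeSemiring using (solve; _:=_; _:+_; _:*_; con)

  indicator : Bool → Carrier
  indicator b = if b then 1# else 0#

  Pr-++ : ∀ {A} (D D′ : Dist A) E → Pr (D ++ D′) E ≈ Pr D E + Pr D′ E
  Pr-++ [] D′ E = sym (+-identityˡ _)
  Pr-++ ((w , a) ∷ D) D′ E = trans (+-congˡ (Pr-++ D D′ E)) (sym (+-assoc _ _ _))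

  Pr-scale : ∀ {A} w (D : Dist A) E → Pr (scale w D) E ≈ w * Pr D E
  Pr-scale w [] E = sym (zeroʳ w)
  Pr-scale w ((v , a) ∷ D) E = begin
    (if E a then w * v else 0#) + Pr (scale w D) E  ≈⟨ +-cong (if-scale (E a)) (Pr-scale w D E) ⟩
    w * (if E a then v else 0#) + w * Pr D E        ≈⟨ sym (distribˡ w _ _) ⟩
    w * ((if E a then v else 0#) + Pr D E)          ∎
    where
    if-scale : ∀ b → (if b then w * v else 0#) ≈ w * (if b then v else 0#)
    if-scale true = ≈-refl
    if-scale false = sym (zeroʳ w)

  Pr-return : ∀ {A} (a : A) E → Pr (return a) E ≈ indicator (E a)
  Pr-return a E = +-identityʳ _

  Pr-mapD : ∀ {A B} (f : A → B) (D : Dist A) E → Pr (mapD f D) E ≡ Pr D (E ∘ f)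
  Pr-mapD f [] E = refl
  Pr-mapD f ((w , a) ∷ D) E = cong (_ +_) (Pr-mapD f D E)

  1-xy≈[1-x]+x[1-y] : ∀ x y → 1# - x * y ≈ (1# - x) + x * (1# - y)
  1-xy≈[1-x]+x[1-y] x y = sym (begin
    (1# - x) + x * (1# - y)           ≈⟨ +-congˡ (x[y-z]≈xy-xz x 1# y) ⟩
    (1# - x) + (x * 1# - x * y)       ≈⟨ +-congˡ (+-congʳ (*-identityʳ x)) ⟩
    (1# + - x) + (x + - (x * y))      ≈⟨ solve 3 (λ x -x -xy → (con 1 :+ -x) :+ (x :+ -xy)
                                                         := con 1 :+ (-x :+ x) :+ -xy)
                                                 ≈-refl x (- x) (- (x * y)) ⟩
    1# + (- x + x) + - (x * y)        ≈⟨ +-congʳ (+-congˡ (-‿inverseˡ x)) ⟩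
    1# + 0# + - (x * y)               ≈⟨ +-congʳ (+-identityʳ 1#) ⟩
    1# - x * y                        ∎)

  -- Under D, f is distributed as d + Bernoulli(q).
  ShiftedBernoulli : ∀ {A} → Dist A → (A → ℕ) → ℕ → Carrier → Set ℓ
  ShiftedBernoulli D f d q = ∀ P → Pr D (P ∘ f) ≈ (1# - q) * indicator (P d) + q * indicator (P (suc d))

  ShiftedBernoulli⇒Pr≟ : ∀ {A} {D : Dist A} {f d q} → ShiftedBernoulli D f d q →
    (Pr D (λ a → does (f a ≟ d)) ≈ 1# - q) × (Pr D (λ a → does (f a ≟ suc d)) ≈ q)
  ShiftedBernoulli⇒Pr≟ {D = D} {f} {d} {q} law = Pr-d , Pr-1+d
    where
    Pr-d : Pr D (λ a → does (f a ≟ d)) ≈ 1# - q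
    Pr-d = begin
      Pr D (λ a → does (f a ≟ d))
        ≈⟨ law (λ m → does (m ≟ d)) ⟩
      (1# - q) * indicator (does (d ≟ d)) + q * indicator (does (suc d ≟ d))
        ≡⟨ cong₂ (λ b b′ → (1# - q) * indicator b + q * indicator b′)
                 (dec-true (d ≟ d) refl) (dec-false (suc d ≟ d) 1+n≢n) ⟩
      (1# - q) * 1# + q * 0#  ≈⟨ +-cong (*-identityʳ _) (zeroʳ q) ⟩
      (1# - q) + 0#           ≈⟨ +-identityʳ _ ⟩
      1# - q                  ∎

    Pr-1+d : Pr D (λ a → does (f a ≟ suc d)) ≈ q
    Pr-1+d = begin
      Pr D (λ a → does (f a ≟ suc d))
        ≈⟨ law (λ m → does (m ≟ suc d)) ⟩
      (1# - q) * indicator (does (d ≟ suc d)) + q * indicator (does (suc d ≟ suc d))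
        ≡⟨ cong₂ (λ b b′ → (1# - q) * indicator b + q * indicator b′)
                 (dec-false (d ≟ suc d) (1+n≢n ∘ ≡.sym)) (dec-true (suc d ≟ suc d) refl) ⟩
      (1# - q) * 0# + q * 1#  ≈⟨ +-cong (zeroʳ _) (*-identityʳ q) ⟩
      0# + q                  ≈⟨ +-identityˡ q ⟩
      q                       ∎

  module _ (p : Carrier) where

    Pr-rebalanceZig-goR : ∀ t l x c E →
      Pr (rebalanceZig p (t , goR l x c)) E
        ≈ p * Pr (rebalanceZig p (node l x t , c)) E + (1# - p) * indicator (E (rotateUpTree (t , goR l x c)))
    Pr-rebalanceZig-goR t l x c E = begin
      Pr (rebalanceZig p (t , goR l x c)) E
        ≡⟨ Pr-mapD rotateUpTree (scale p A ++ scale (1# - p) (return f)) E ⟩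
      Pr (scale p A ++ scale (1# - p) (return f)) E′
        ≈⟨ Pr-++ (scale p A) _ E′ ⟩
      Pr (scale p A) E′ + Pr (scale (1# - p) (return f)) E′
        ≈⟨ +-cong (Pr-scale p A E′) (Pr-scale (1# - p) (return f) E′) ⟩
      p * Pr A E′ + (1# - p) * Pr (return f) E′
        ≈⟨ +-cong (*-congˡ (reflexive (≡.sym (Pr-mapD rotateUpTree A E)))) (*-congˡ (Pr-return f E′)) ⟩
      p * Pr (rebalanceZig p (node l x t , c)) E + (1# - p) * indicator (E′ f) ∎
      where
      f : Focus
      f = t , goR l x c
      A : Dist Focus
      A = walkUp p (node l x t) c
      E′ : Focus → Bool
      E′ = E ∘ rotateUpTree

    -- The hypothesis is on the whole tree plug t c, which does not change when the focus
    -- moves up, so it passes unchanged to the recursive call.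
    rebalanceZig-rightHeight : ∀ {t c n d} → RightSpine c n → NonEmpty t → rightHeight (plug t c) ≡ suc d →
      ShiftedBernoulli (rebalanceZig p (t , c)) rightHeight d (p ^ n)
    rebalanceZig-rightHeight {node a y b} {d = d} top node h≡1+d P = begin
      Pr (return (node a y b)) (P ∘ rightHeight)  ≈⟨ Pr-return (node a y b) (P ∘ rightHeight) ⟩
      indicator (P (rightHeight (node a y b)))    ≡⟨ cong (indicator ∘ P) h≡1+d ⟩
      v                                           ≈⟨ sym (+-identityˡ v) ⟩
      0# + v                                      ≈⟨ +-cong (sym (zeroˡ u)) (sym (*-identityˡ v)) ⟩
      0# * u + 1# * v                             ≈⟨ +-congʳ (*-congʳ (sym (-‿inverseʳ 1#))) ⟩
      (1# - 1#) * u + 1# * v                      ∎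
      where
      u v : Carrier
      u = indicator (P d)
      v = indicator (P (suc d))
    rebalanceZig-rightHeight {node a y b} {goR l x c} {suc n} {d} (goR s) node h≡1+d P = begin
      Pr (rebalanceZig p (node a y b , goR l x c)) E
        ≈⟨ Pr-rebalanceZig-goR _ l x c E ⟩
      p * Pr (rebalanceZig p (node l x (node a y b) , c)) E + (1# - p) * indicator (E rotated)
        ≈⟨ +-cong (*-congˡ (rebalanceZig-rightHeight s node h≡1+d P))
                  (*-congˡ (reflexive (cong (indicator ∘ P) rotated-height))) ⟩
      p * ((1# - q) * u + q * v) + (1# - p) * u
        ≈⟨ solve 6 (λ p q p̄ q̄ u v → p :* (q̄ :* u :+ q :* v) :+ p̄ :* u
                                   := (p̄ :+ p :* q̄) :* u :+ p :* q :* v)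
                   ≈-refl p q (1# - p) (1# - q) u v ⟩
      ((1# - p) + p * (1# - q)) * u + p * q * v
        ≈⟨ +-congʳ (*-congʳ (sym (1-xy≈[1-x]+x[1-y] p q))) ⟩
      (1# - p * q) * u + p * q * v ∎
      where
      E : Tree → Bool
      E = P ∘ rightHeight
      rotated : Tree
      rotated = rotateUpTree (node a y b , goR l x c)
      rotated-height : rightHeight rotated ≡ d
      rotated-height = suc-injective (≡.trans (rightHeight-rotateUpTree-goR s) h≡1+d)
      q u v : Carrier
      q = p ^ n
      u = indicator (P d)
      v = indicator (P (suc d))

    insertZig-rightHeight : ∀ {t k d} → NonEmpty t → AllKeys (_< k) t → rightHeight t ≡ d →
      ShiftedBernoulli (insertZig p k t) rightHeight d (p ^ suc d)
    insertZig-rightHeight {t} {k} nonEmpty t<k refl P = begin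
      Pr (insertZig p k t) (P ∘ rightHeight)
        ≡⟨ cong (λ f → Pr (rebalanceZig p f) (P ∘ rightHeight)) (insertZ-above top t<k) ⟩
      Pr (rebalanceZig p (node leaf k leaf , descendRight t top)) (P ∘ rightHeight)
        ≈⟨ rebalanceZig-rightHeight newLeafDepth node (rightHeight-plug newLeafDepth node) P ⟩
      (1# - q) * indicator (P (rightHeight t)) + q * indicator (P (suc (rightHeight t))) ∎
      where
      q : Carrier
      q = p ^ suc (rightHeight t)
      newLeafDepth : RightSpine (descendRight t top) (suc (rightHeight t))
      newLeafDepth = subst (RightSpine _) (ℕₚ.+-identityʳ _) (descendRight-rightSpine t nonEmpty top)

lemma8 : ∀ {c ℓ} (R : CommutativeRing c ℓ) (p : CommutativeRing.Carrier R)
    (t : Tree) (k d : ℕ) →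
    IsBST t → NonEmpty t → AllKeys (_< k) t → rightHeight t ≡ d →
    let open CommutativeRing R
        open Prob R
    in (Pr (insertZig p k t) (rightHeightIs p d) ≈ 1# - p ^ suc d)
       × (Pr (insertZig p k t) (rightHeightIs p (suc d)) ≈ p ^ suc d)
lemma8 R p t k d _ nonEmpty t<k rh≡d =
  ShiftedBernoulli⇒Pr≟ R {D = Prob.insertZig R p k t} {f = rightHeight}
    (insertZig-rightHeight R p nonEmpty t<k rh≡d)
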